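{- There are infinitely many positive integers $n$ for which there exists a non-bipartite projective quadrangulation on $n$ vertices containing no odd cycle transversal of size less than $\sqrt{n}$.
   Context: A projective quadrangulation is a graph embedded in the real projective plane $\mathbb{P}^2$ so that every face is bounded by four edges. A non-bipartite projective quadrangulation is such a graph that is not bipartite. An odd cycle transversal of a graph $G$ is a set $S$ of vertices such that $G-S$ is bipartite. -}

module Defs where

-- Combinatorial (graph-encoded-map / "gem") description of a graph
-- cellularly embedded in a closed surface, specialised to quadrangulations
-- of the real projective plane.
--
-- A map is given by a finite set of flags (Fin (8 * f)) and three
-- fixed-point-free involutions τ₀ τ₁ τ₂ with τ₀τ₂ = τ₂τ₀ also a fixed-point-free
-- involution, and <τ₀,τ₁,τ₂> transitive (connected surface).
--   vertices = <τ₁,τ₂>-orbits,  edges = <τ₀,τ₂>-orbits (always 4 flags),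
--   faces    = <τ₀,τ₁>-orbits  (a face of length k has 2k flags).
-- Vertices are labelled by Fin n through a map  vtx  whose fibres are exactly
-- the <τ₁,τ₂>-orbits.  The edge with flag x joins  vtx x  and  vtx (τ₀ x).
-- Every face has exactly 4 edges  ⇔  τ₀∘τ₁ has order exactly 4 at every flag.
-- Then #flags = 8·F, E = #flags / 4 = 2F, and the surface is the projective
-- plane iff the Euler characteristic V − E + F equals 1 (a connected closed
-- surface with χ = 1 is the projective plane).

open import Data.Nat using (ℕ; zero; suc; _+_; _*_)
open import Data.Fin using (Fin)
open import Data.Fin.Subset using (Subset; _∈_; _∉_)
open import Data.Bool using (Bool)
open import Data.Sum using (_⊎_)
open import Data.Product using (∃)
open import Function using (_∘_; Surjective)
open import Relation.Binary.PropositionalEquality using (_≡_; _≢_)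
open import Relation.Binary.Construct.Closure.ReflexiveTransitive using (Star)
open import Relation.Nullary using (¬_)

iter : ∀ {A : Set} → ℕ → (A → A) → A → A
iter zero    g x = x
iter (suc k) g x = g (iter k g x)

Step₂ : ∀ {A : Set} → (A → A) → (A → A) → A → A → Set
Step₂ σ π x y = y ≡ σ x ⊎ y ≡ π x

Step₃ : ∀ {A : Set} → (A → A) → (A → A) → (A → A) → A → A → Set
Step₃ σ π ρ x y = y ≡ σ x ⊎ (y ≡ π x ⊎ y ≡ ρ x)

IsFPFInvolution : ∀ {A : Set} → (A → A) → Set
IsFPFInvolution {A} σ = (∀ (x : A) → σ (σ x) ≡ x) × (∀ (x : A) → σ x ≢ x)
  where open import Data.Product using (_×_)

record ProjQuad (n : ℕ) : Set where
  field
    f   : ℕ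
    τ₀  : Fin (8 * f) → Fin (8 * f)
    τ₁  : Fin (8 * f) → Fin (8 * f)
    τ₂  : Fin (8 * f) → Fin (8 * f)
    τ₀-inv : IsFPFInvolution τ₀
    τ₁-inv : IsFPFInvolution τ₁
    τ₂-inv : IsFPFInvolution τ₂
    τ₀τ₂-comm : ∀ x → τ₀ (τ₂ x) ≡ τ₂ (τ₀ x)
    τ₀τ₂-fpf  : ∀ x → τ₀ (τ₂ x) ≢ x
    connected : ∀ x y → Star (Step₃ τ₀ τ₁ τ₂) x y
    vtx        : Fin (8 * f) → Fin n
    vtx-surj   : Surjective _≡_ _≡_ vtx
    vtx-τ₁     : ∀ x → vtx (τ₁ x) ≡ vtx x
    vtx-τ₂     : ∀ x → vtx (τ₂ x) ≡ vtx x
    vtx-orbit  : ∀ x y → vtx x ≡ vtx y → Star (Step₂ τ₁ τ₂) x y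
    face4      : ∀ x → iter 4 (τ₀ ∘ τ₁) x ≡ x
    face-not2  : ∀ x → iter 2 (τ₀ ∘ τ₁) x ≢ x
    euler      : n + f ≡ 2 * f + 1

module _ {n : ℕ} (Q : ProjQuad n) where
  open ProjQuad Q

  Adj : Fin n → Fin n → Set
  Adj u w = ∃ λ x → vtx x ≡ u × vtx (τ₀ x) ≡ w
    where open import Data.Product using (_×_)

  -- G − S is bipartite: a 2-colouring of vertices outside S with every
  -- edge of G − S bichromatic (loops are never bichromatic).
  BipartiteMinus : Subset n → Set
  BipartiteMinus S = ∃ λ (c : Fin n → Bool) →
    ∀ u w → Adj u w → u ∉ S → w ∉ S → c u ≢ c w

  IsOddCycleTransversal : Subset n → Set
  IsOddCycleTransversal S = BipartiteMinus S

  Bipartite : Set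
  Bipartite = ∃ λ (c : Fin n → Bool) → ∀ u w → Adj u w → c u ≢ c w

{-# OPTIONS --safe #-}
-- The quadrangulation is the (M + 1) × (M + 1) grid of vertices (x , y), closed up into the projective
-- plane by joining the end of row y to the start of row M ∸ y and the top of column x to the bottom of
-- column M ∸ x; it has (M + 1)² vertices and (M + 1)² − 1 quadrilateral faces.
-- If a 2-colouring c is proper off a set S, then parity (x + y) xor c (x , y) is constant along S-free
-- grid edges and flips across a twisted edge. Hence S meets every cycle that runs along row y from
-- column x₀ to the end, crosses to row M ∸ y, returns to column x₀ and closes up inside that column.
-- If every column meets S, then ∣ S ∣ ≥ M + 1. Otherwise some column x₀ misses S, and each y gives a
-- vertex of S on row y right of x₀ or on row M ∸ y left of x₀, from which y can be read off.
-- Either way ∣ S ∣² ≥ (M + 1)² = n; for S = ∅ this says that the quadrangulation is not bipartite.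
module Submission where

open import Defs
open import Data.Nat using (ℕ; _≤_; _<_; _*_)
open import Data.Product using (∃; _×_)
open import Data.Fin.Subset using (Subset; ∣_∣)
open import Relation.Nullary using (¬_)

open import Data.Bool using (Bool; true; false; not; _xor_)
open import Data.Bool.Properties using (not-involutive; not-distribˡ-xor; not-distribʳ-xor; xor-assoc; xor-same; ¬-not; not-¬)
open import Data.Empty using (⊥; ⊥-elim)
import Data.Empty.Irrelevant as Irrelevant
open import Data.Fin using (Fin; zero; suc; toℕ; combine; remQuot; inject₁; lower₁)
open import Data.Fin.Patterns using (0F; 1F; 2F; 3F)
open import Data.Fin.Properties
  using (suc-injective; toℕ-injective; toℕ-fromℕ<; toℕ<n; toℕ≤pred[n]; injective⇒≤; combine-injective; toℕ-combine
        ; combine-remQuot; toℕ-inject₁; inject₁-lower₁; inject₁≡⇒lower₁≡; 2↔Bool; *↔×)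
open import Data.Fin.Subset using (_∈_; _∉_; inside; outside) renaming (⊥ to ∅)
open import Data.Fin.Subset.Properties using (_∈?_; ∣⊥∣≡0)
open import Data.Nat using (zero; suc; _+_; _∸_; _≤′_; ≤′-step; ≤′-refl; z≤n; s≤s; _≤?_; _<?_; _≟_)
open import Data.Nat.DivMod using (_mod_; m<n⇒m%n≡m)
open import Data.Nat.Properties hiding (suc-injective)
open import Data.Product using (_,_; proj₁; proj₂)
open import Data.Product.Function.NonDependent.Propositional using (_×-↔_)
open import Data.Sum using (_⊎_; inj₁; inj₂; swap)
open import Data.Vec.Base using (_∷_; here; there)
open import Function using (_∘_; _↔_; Inverse; Surjective; mk↔ₛ′)
open import Function.Bundles using (Surjection)
import Function.Construct.Composition as Compose
open import Function.Properties.Inverse using (↔⇒↠; ↔-sym; ↔-trans)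
open import Relation.Binary.Construct.Closure.ReflexiveTransitive using (Star; ε; _◅_; _◅◅_; map; reverse; gmap)
open import Relation.Binary.PropositionalEquality
open import Relation.Nullary using (Dec; yes; no; contradiction; ¬?)
open import Relation.Nullary.Decidable using (_×-dec_; _⊎-dec_; recompute; decidable-stable)

rank : ∀ {k} (p : Subset k) {i} → i ∈ p → Fin ∣ p ∣
rank (inside ∷ p)  here        = zero
rank (inside ∷ p)  (there i∈p) = suc (rank p i∈p)
rank (outside ∷ p) (there i∈p) = rank p i∈p

rank-injective : ∀ {k} (p : Subset k) {i j} (i∈p : i ∈ p) (j∈p : j ∈ p) → rank p i∈p ≡ rank p j∈p → i ≡ j
rank-injective (inside ∷ p)  here      here      _  = refl
rank-injective (inside ∷ p)  (there a) (there b) eq = cong suc (rank-injective p a b (suc-injective eq))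
rank-injective (outside ∷ p) (there a) (there b) eq = cong suc (rank-injective p a b eq)

injective⇒≤∣p∣ : ∀ {m k} (p : Subset k) (g : Fin m → Fin k) → (∀ i → g i ∈ p) → (∀ {i j} → g i ≡ g j → i ≡ j) → m ≤ ∣ p ∣
injective⇒≤∣p∣ p g g∈p g-inj = injective⇒≤ (λ eq → g-inj (rank-injective p (g∈p _) (g∈p _) eq))

parity : ℕ → Bool
parity zero    = false
parity (suc n) = not (parity n)

parity-+ : ∀ m n → parity (m + n) ≡ parity m xor parity n
parity-+ zero    n = refl
parity-+ (suc m) n = trans (cong not (parity-+ m n)) (not-distribˡ-xor (parity m) (parity n))

parity-double : ∀ m → parity (m + m) ≡ false
parity-double m = trans (parity-+ m m) (xor-same (parity m))

parity-twist : ∀ y y′ → parity (y + y′ + y) ≡ parity y′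
parity-twist y y′ = begin
  parity (y + y′ + y)    ≡⟨ cong parity (+-comm (y + y′) y) ⟩
  parity (y + (y + y′))  ≡⟨ cong parity (sym (+-assoc y y y′)) ⟩
  parity (y + y + y′)    ≡⟨ parity-+ (y + y) y′ ⟩
  parity (y + y) xor parity y′ ≡⟨ cong (_xor parity y′) (parity-double y) ⟩
  parity y′              ∎
  where open ≡-Reasoning

xor-cancelˡ : ∀ o t → o xor (o xor t) ≡ t
xor-cancelˡ o t = trans (sym (xor-assoc o o t)) (cong (_xor t) (xor-same o))

not-xor-not : ∀ x y → not x xor not y ≡ x xor y
not-xor-not false y = not-involutive y
not-xor-not true  y = refl

stable-between : ∀ {A : Set} (g : ℕ → A) {a b} → a ≤′ b → (∀ {x} → a ≤ x → x < b → g (suc x) ≡ g x) → g b ≡ g a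
stable-between g ≤′-refl             _    = refl
stable-between g (≤′-step {b} a≤′b) step =
  trans (step (≤′⇒≤ a≤′b) (n<1+n b)) (stable-between g a≤′b (λ a≤x x<b → step a≤x (m<n⇒m<1+n x<b)))

-- Odd cycle transversals of Möbius grids

record MöbiusGrid {n : ℕ} (E : Fin n → Fin n → Set) (M : ℕ) : Set where
  field
    node           : ℕ → ℕ → Fin n
    node-injective : ∀ {x y x′ y′} → x ≤ M → y ≤ M → x′ ≤ M → y′ ≤ M → node x y ≡ node x′ y′ → x ≡ x′ × y ≡ y′
    horizontal     : ∀ {x y} → x < M → y ≤ M → E (node x y) (node (suc x) y)
    vertical       : ∀ {x y} → x ≤ M → y < M → E (node x y) (node x (suc y))
    twisted        : ∀ {y y′} → y + y′ ≡ M → E (node M y) (node 0 y′)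

module _ {n M} {E : Fin n → Fin n → Set} (G : MöbiusGrid E M) (S : Subset n) (c : Fin n → Bool)
         (proper : ∀ u w → E u w → u ∉ S → w ∉ S → c u ≢ c w) where
  open MöbiusGrid G

  private
    φ : ℕ → ℕ → Bool
    φ x y = parity (x + y) xor c (node x y)

    flips : ∀ {u w} → E u w → u ∉ S → w ∉ S → c w ≡ not (c u)
    flips {u} {w} e u∉S w∉S = ¬-not (λ eq → proper u w e u∉S w∉S (sym eq))

    φ-horizontal : ∀ {x y} → x < M → y ≤ M → node x y ∉ S → node (suc x) y ∉ S → φ (suc x) y ≡ φ x y
    φ-horizontal {x} {y} x<M y≤M ∉S ∉S′ =
      trans (cong (not (parity (x + y)) xor_) (flips (horizontal x<M y≤M) ∉S ∉S′)) (not-xor-not (parity (x + y)) (c (node x y)))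

    φ-vertical : ∀ {x y} → x ≤ M → y < M → node x y ∉ S → node x (suc y) ∉ S → φ x (suc y) ≡ φ x y
    φ-vertical {x} {y} x≤M y<M ∉S ∉S′ =
      trans (cong₂ (λ k b → parity k xor b) (+-suc x y) (flips (vertical x≤M y<M) ∉S ∉S′)) (not-xor-not (parity (x + y)) (c (node x y)))

    φ-twisted : ∀ {y y′} → y + y′ ≡ M → node M y ∉ S → node 0 y′ ∉ S → φ 0 y′ ≡ not (φ M y)
    φ-twisted {y} {y′} y+y′≡M ∉S ∉S′ = begin
      parity y′ xor c (node 0 y′)            ≡⟨ cong (parity y′ xor_) (flips (twisted y+y′≡M) ∉S ∉S′) ⟩
      parity y′ xor not (c (node M y))       ≡⟨ not-distribʳ-xor (parity y′) _ ⟨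
      not (parity y′ xor c (node M y))       ≡⟨ cong (λ b → not (b xor c (node M y))) (parity-twist y y′) ⟨
      not (parity (y + y′ + y) xor c (node M y)) ≡⟨ cong (λ m → not (parity (m + y) xor c (node M y))) y+y′≡M ⟩
      not (φ M y)                            ∎
      where open ≡-Reasoning

    φ-row : ∀ {y a b} → y ≤ M → a ≤ b → b ≤ M → (∀ {x} → a ≤ x → x ≤ b → node x y ∉ S) → φ b y ≡ φ a y
    φ-row {y} y≤M a≤b b≤M free = stable-between (λ x → φ x y) (≤⇒≤′ a≤b) λ a≤x x<b →
      φ-horizontal (<-≤-trans x<b b≤M) y≤M (free a≤x (<⇒≤ x<b)) (free (m≤n⇒m≤1+n a≤x) x<b)

    φ-column : ∀ {x y} → x ≤ M → y ≤ M → (∀ {z} → z ≤ M → node x z ∉ S) → φ x y ≡ φ x 0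
    φ-column {x} x≤M y≤M free = stable-between (φ x) (≤⇒≤′ z≤n) λ _ z<y →
      φ-vertical x≤M (<-≤-trans z<y y≤M) (free (<⇒≤ (<-≤-trans z<y y≤M))) (free (<-≤-trans z<y y≤M))

    no-free-odd-cycle : ∀ {x₀ y y′} → x₀ ≤ M → y + y′ ≡ M
      → (∀ {x} → x₀ ≤ x → x ≤ M → node x y ∉ S)
      → (∀ {x} → 0 ≤ x → x ≤ x₀ → node x y′ ∉ S)
      → (∀ {z} → z ≤ M → node x₀ z ∉ S) → ⊥
    no-free-odd-cycle {x₀} {y} {y′} x₀≤M y+y′≡M row row′ column = not-¬ refl (begin
      φ x₀ y        ≡⟨ φ-column x₀≤M y≤M column ⟩
      φ x₀ 0        ≡⟨ φ-column x₀≤M y′≤M column ⟨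
      φ x₀ y′       ≡⟨ φ-row y′≤M z≤n x₀≤M row′ ⟩
      φ 0 y′        ≡⟨ φ-twisted y+y′≡M (row x₀≤M ≤-refl) (row′ z≤n z≤n) ⟩
      not (φ M y)   ≡⟨ cong not (φ-row y≤M x₀≤M ≤-refl row) ⟩
      not (φ x₀ y)  ∎)
      where
      open ≡-Reasoning
      y≤M : y ≤ M
      y≤M = subst (y ≤_) y+y′≡M (m≤m+n y y′)
      y′≤M : y′ ≤ M
      y′≤M = subst (y′ ≤_) y+y′≡M (m≤n+m y′ y)

    MeetsColumn : ℕ → Set
    MeetsColumn x = ∃ λ y → y < suc M × node x y ∈ S

    meetsColumn? : ∀ x → Dec (MeetsColumn x)
    meetsColumn? x = anyUpTo? (λ y → node x y ∈? S) (suc M)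

    -- a vertex of S on the odd cycle through column x₀ and rows y and M ∸ y, outside column x₀
    Blocker : ℕ → ℕ → Set
    Blocker x₀ y = ∃ λ x → x < suc M × ((x₀ < x × node x y ∈ S) ⊎ (x < x₀ × node x (M ∸ y) ∈ S))

    blocker : ∀ {x₀ y} → x₀ ≤ M → y ≤ M → ¬ MeetsColumn x₀ → Blocker x₀ y
    blocker {x₀} {y} x₀≤M y≤M free with anyUpTo? (λ x → ((x₀ <? x) ×-dec (node x y ∈? S)) ⊎-dec ((x <? x₀) ×-dec (node x (M ∸ y) ∈? S))) (suc M)
    ... | yes b = b
    ... | no none = ⊥-elim (no-free-odd-cycle x₀≤M (m+[n∸m]≡n y≤M) row row′ column)
      where
      column : ∀ {z} → z ≤ M → node x₀ z ∉ S
      column z≤M ∈S = free (_ , s≤s z≤M , ∈S)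
      row : ∀ {x} → x₀ ≤ x → x ≤ M → node x y ∉ S
      row x₀≤x x≤M ∈S with m≤n⇒m<n∨m≡n x₀≤x
      ... | inj₁ x₀<x = none (_ , s≤s x≤M , inj₁ (x₀<x , ∈S))
      ... | inj₂ refl = column y≤M ∈S
      row′ : ∀ {x} → 0 ≤ x → x ≤ x₀ → node x (M ∸ y) ∉ S
      row′ _ x≤x₀ ∈S with m≤n⇒m<n∨m≡n x≤x₀
      ... | inj₁ x<x₀ = none (_ , s≤s (≤-trans (<⇒≤ x<x₀) x₀≤M) , inj₂ (x<x₀ , ∈S))
      ... | inj₂ refl = column (m∸n≤m M y) ∈S

    blocker-node : ∀ {x₀ y} → Blocker x₀ y → Fin n
    blocker-node {y = y} (x , _ , inj₁ _) = node x y
    blocker-node {y = y} (x , _ , inj₂ _) = node x (M ∸ y)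

    blocker-node∈S : ∀ {x₀ y} (b : Blocker x₀ y) → blocker-node b ∈ S
    blocker-node∈S (_ , _ , inj₁ (_ , ∈S)) = ∈S
    blocker-node∈S (_ , _ , inj₂ (_ , ∈S)) = ∈S

    blocker-node-injective : ∀ {x₀ y y′} → y ≤ M → y′ ≤ M → (b : Blocker x₀ y) (b' : Blocker x₀ y′) →
                             blocker-node b ≡ blocker-node b' → y ≡ y′
    blocker-node-injective {y = y} {y′} y≤M y′≤M (x , x<K , inj₁ _) (x′ , x′<K , inj₁ _) eq =
      proj₂ (node-injective (≤-pred x<K) y≤M (≤-pred x′<K) y′≤M eq)
    blocker-node-injective {y = y} {y′} y≤M y′≤M (x , x<K , inj₁ (x₀<x , _)) (x′ , x′<K , inj₂ (x′<x₀ , _)) eq =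
      contradiction (proj₁ (node-injective (≤-pred x<K) y≤M (≤-pred x′<K) (m∸n≤m M y′) eq)) (<⇒≢ (<-trans x′<x₀ x₀<x) ∘ sym)
    blocker-node-injective {y = y} {y′} y≤M y′≤M (x , x<K , inj₂ (x<x₀ , _)) (x′ , x′<K , inj₁ (x₀<x′ , _)) eq =
      contradiction (proj₁ (node-injective (≤-pred x<K) (m∸n≤m M y) (≤-pred x′<K) y′≤M eq)) (<⇒≢ (<-trans x<x₀ x₀<x′))
    blocker-node-injective {y = y} {y′} y≤M y′≤M (x , x<K , inj₂ _) (x′ , x′<K , inj₂ _) eq =
      ∸-cancelˡ-≡ y≤M y′≤M (proj₂ (node-injective (≤-pred x<K) (m∸n≤m M y) (≤-pred x′<K) (m∸n≤m M y′) eq))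

  oddCycleTransversal-size : suc M ≤ ∣ S ∣
  oddCycleTransversal-size with anyUpTo? (λ x → ¬? (meetsColumn? x)) (suc M)
  ... | yes (x₀ , x₀<K , free) =
    injective⇒≤∣p∣ S (λ Y → blocker-node (blocker′ Y)) (λ Y → blocker-node∈S (blocker′ Y))
      (λ {Y} {Y′} eq → toℕ-injective (blocker-node-injective (toℕ≤pred[n] Y) (toℕ≤pred[n] Y′) (blocker′ Y) (blocker′ Y′) eq))
    where
    blocker′ : (Y : Fin (suc M)) → Blocker x₀ (toℕ Y)
    blocker′ Y = blocker (≤-pred x₀<K) (toℕ≤pred[n] Y) free
  ... | no none =
    injective⇒≤∣p∣ S (λ X → node (toℕ X) (proj₁ (meets X))) (λ X → proj₂ (proj₂ (meets X)))
      (λ {X} {X′} eq → toℕ-injective (proj₁ (node-injective (toℕ≤pred[n] X) (≤-pred (proj₁ (proj₂ (meets X)))) (toℕ≤pred[n] X′) (≤-pred (proj₁ (proj₂ (meets X′)))) eq)))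
    where
    meets : (X : Fin (suc M)) → MeetsColumn (toℕ X)
    meets X = decidable-stable (meetsColumn? (toℕ X)) (λ free → none (toℕ X , toℕ<n X , free))

-- Quadrangulations of the projective plane from flags of an arbitrary type

Step₂⇒Step₃ : ∀ {A : Set} {σ π ρ : A → A} {x y} → Step₂ π ρ x y → Step₃ σ π ρ x y
Step₂⇒Step₃ (inj₁ eq) = inj₂ (inj₁ eq)
Step₂⇒Step₃ (inj₂ eq) = inj₂ (inj₂ eq)

Step₂-sym : ∀ {A : Set} {π ρ : A → A} → IsFPFInvolution π → IsFPFInvolution ρ → ∀ {x y} → Step₂ π ρ x y → Step₂ π ρ y x
Step₂-sym (π-inv , _) _ (inj₁ refl) = inj₁ (sym (π-inv _))
Step₂-sym _ (ρ-inv , _) (inj₂ refl) = inj₂ (sym (ρ-inv _))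

Step₃-sym : ∀ {A : Set} {σ π ρ : A → A} → IsFPFInvolution σ → IsFPFInvolution π → IsFPFInvolution ρ →
            ∀ {x y} → Step₃ σ π ρ x y → Step₃ σ π ρ y x
Step₃-sym (σ-inv , _) _ _ (inj₁ refl) = inj₁ (sym (σ-inv _))
Step₃-sym _ π ρ (inj₂ step) = inj₂ (Step₂-sym π ρ step)

record QuadFlags (F : Set) (n : ℕ) : Set where
  field
    τ₀ τ₁ τ₂   : F → F
    τ₀-inv     : IsFPFInvolution τ₀
    τ₁-inv     : IsFPFInvolution τ₁
    τ₂-inv     : IsFPFInvolution τ₂
    τ₀τ₂-comm  : ∀ x → τ₀ (τ₂ x) ≡ τ₂ (τ₀ x)
    τ₀τ₂-fpf   : ∀ x → τ₀ (τ₂ x) ≢ x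
    connected  : ∀ x y → Star (Step₃ τ₀ τ₁ τ₂) x y
    vtx        : F → Fin n
    vtx-surj   : Surjective _≡_ _≡_ vtx
    vtx-τ₁     : ∀ x → vtx (τ₁ x) ≡ vtx x
    vtx-τ₂     : ∀ x → vtx (τ₂ x) ≡ vtx x
    vtx-orbit  : ∀ x y → vtx x ≡ vtx y → Star (Step₂ τ₁ τ₂) x y
    face4      : ∀ x → iter 4 (τ₀ ∘ τ₁) x ≡ x
    face-not2  : ∀ x → iter 2 (τ₀ ∘ τ₁) x ≢ x

module Transport {F : Set} {n f : ℕ} (Φ : QuadFlags F n) (ι : F ↔ Fin (8 * f)) where
  open QuadFlags Φ
  open Inverse ι using (to; from; strictlyInverseˡ; strictlyInverseʳ)

  conj : (F → F) → Fin (8 * f) → Fin (8 * f)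
  conj σ = to ∘ σ ∘ from

  conj-from : ∀ σ i → from (conj σ i) ≡ σ (from i)
  conj-from σ i = strictlyInverseʳ (σ (from i))

  conj-to : ∀ σ x → conj σ (to x) ≡ to (σ x)
  conj-to σ x = cong (to ∘ σ) (strictlyInverseʳ x)

  conj-∘ : ∀ σ π i → conj σ (conj π i) ≡ conj (σ ∘ π) i
  conj-∘ σ π i = conj-to σ (π (from i))

  conj-iter : ∀ σ π k i → iter k (conj σ ∘ conj π) i ≡ conj (iter k (σ ∘ π)) i
  conj-iter σ π zero    i = sym (strictlyInverseˡ i)
  conj-iter σ π (suc k) i = trans (cong (conj σ ∘ conj π) (conj-iter σ π k i)) (trans (conj-∘ σ π _) (conj-∘ (σ ∘ π) (iter k (σ ∘ π)) i))

  conj-identity : ∀ {σ} → (∀ x → σ x ≡ x) → ∀ i → conj σ i ≡ i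
  conj-identity σ≗id i = trans (cong to (σ≗id (from i))) (strictlyInverseˡ i)

  conj-fixed : ∀ σ {i} → conj σ i ≡ i → σ (from i) ≡ from i
  conj-fixed σ {i} eq = trans (sym (conj-from σ i)) (cong from eq)

  conj-fpfInvolution : ∀ {σ} → IsFPFInvolution σ → IsFPFInvolution (conj σ)
  conj-fpfInvolution {σ} (involutive , fpf) =
    (λ i → trans (conj-∘ σ σ i) (conj-identity involutive i)) , (λ i eq → fpf (from i) (conj-fixed σ eq))

  conj-step : ∀ σ {x y} → y ≡ σ x → to y ≡ conj σ (to x)
  conj-step σ {x} refl = sym (conj-to σ x)

  conj-star : ∀ {R : F → F → Set} {R′ : Fin (8 * f) → Fin (8 * f) → Set} →
              (∀ {x y} → R x y → R′ (to x) (to y)) → ∀ i j → Star R (from i) (from j) → Star R′ i j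
  conj-star {R′ = R′} step i j path = subst₂ (Star R′) (strictlyInverseˡ i) (strictlyInverseˡ j) (gmap to step path)

  projQuad : n + f ≡ 2 * f + 1 → ProjQuad n
  projQuad euler = record
    { f         = f
    ; τ₀        = conj τ₀
    ; τ₁        = conj τ₁
    ; τ₂        = conj τ₂
    ; τ₀-inv    = conj-fpfInvolution τ₀-inv
    ; τ₁-inv    = conj-fpfInvolution τ₁-inv
    ; τ₂-inv    = conj-fpfInvolution τ₂-inv
    ; τ₀τ₂-comm = λ i → trans (conj-∘ τ₀ τ₂ i) (trans (cong to (τ₀τ₂-comm (from i))) (sym (conj-∘ τ₂ τ₀ i)))
    ; τ₀τ₂-fpf  = λ i eq → τ₀τ₂-fpf (from i) (conj-fixed (τ₀ ∘ τ₂) (trans (sym (conj-∘ τ₀ τ₂ i)) eq))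
    ; connected = λ i j → conj-star step₃ i j (connected (from i) (from j))
    ; vtx       = vtx ∘ from
    ; vtx-surj  = Compose.surjective _≡_ _≡_ _≡_ {f = from} {g = vtx} (Surjection.surjective (↔⇒↠ (↔-sym ι))) vtx-surj
    ; vtx-τ₁    = λ i → trans (cong vtx (conj-from τ₁ i)) (vtx-τ₁ (from i))
    ; vtx-τ₂    = λ i → trans (cong vtx (conj-from τ₂ i)) (vtx-τ₂ (from i))
    ; vtx-orbit = λ i j eq → conj-star step₂ i j (vtx-orbit (from i) (from j) eq)
    ; face4     = λ i → trans (conj-iter τ₀ τ₁ 4 i) (conj-identity face4 i)
    ; face-not2 = λ i eq → face-not2 (from i) (conj-fixed (iter 2 (τ₀ ∘ τ₁)) (trans (sym (conj-iter τ₀ τ₁ 2 i)) eq))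
    ; euler     = euler
    }
    where
    step₂ : ∀ {x y} → Step₂ τ₁ τ₂ x y → Step₂ (conj τ₁) (conj τ₂) (to x) (to y)
    step₂ (inj₁ eq) = inj₁ (conj-step τ₁ eq)
    step₂ (inj₂ eq) = inj₂ (conj-step τ₂ eq)
    step₃ : ∀ {x y} → Step₃ τ₀ τ₁ τ₂ x y → Step₃ (conj τ₀) (conj τ₁) (conj τ₂) (to x) (to y)
    step₃ (inj₁ eq)        = inj₁ (conj-step τ₀ eq)
    step₃ (inj₂ (inj₁ eq)) = inj₂ (inj₁ (conj-step τ₁ eq))
    step₃ (inj₂ (inj₂ eq)) = inj₂ (inj₂ (conj-step τ₂ eq))

  projQuad-adj : ∀ euler x → Adj (projQuad euler) (vtx x) (vtx (τ₀ x))
  projQuad-adj euler x = to x , cong vtx (strictlyInverseʳ x) , cong vtx (trans (conj-from τ₀ (to x)) (cong τ₀ (strictlyInverseʳ x)))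

-- The projective grid

module ProjectiveGridMap (p : ℕ) where
  M : ℕ
  M = suc p

  K : ℕ
  K = suc M

  -- Cell x y is the square with lower left corner (x , y); the cells in the last row and column
  -- cross the twisted sides, and there is no cell (M , M).
  record Cell : Set where
    constructor cell
    field
      x y       : ℕ
      .x≤M      : x ≤ M
      .y≤M      : y ≤ M
      .notCorner : x < M ⊎ y < M

  cell-cong : ∀ {x y x′ y′} .{a b c a′ b′ c′} → x ≡ x′ → y ≡ y′ → cell x y a b c ≡ cell x′ y′ a′ b′ c′
  cell-cong refl refl = refl

  data Side : Set where
    bottom right top left : Side

  next prev : Side → Side
  next bottom = right
  next right  = top
  next top    = left
  next left   = bottom
  prev bottom = left
  prev right  = bottom
  prev top    = right
  prev left   = top

  prev-next : ∀ d → prev (next d) ≡ d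
  prev-next bottom = refl
  prev-next right  = refl
  prev-next top    = refl
  prev-next left   = refl

  next-prev : ∀ d → next (prev d) ≡ d
  next-prev bottom = refl
  next-prev right  = refl
  next-prev top    = refl
  next-prev left   = refl

  -- flag c d false (true) is the flag of cell c at the start (end) of side d, sides running counter-clockwise.
  record Flag : Set where
    constructor flag
    field
      cell′ : Cell
      side  : Side
      end   : Bool

  τ₀ τ₁ : Flag → Flag
  τ₀ (flag c d t)     = flag c d (not t)
  τ₁ (flag c d true)  = flag c (next d) false
  τ₁ (flag c d false) = flag c (prev d) true

  recompute≤ : ∀ {a b} → .(a ≤ b) → a ≤ b
  recompute≤ {a} {b} = recompute (a ≤? b)

  recomputeNotCorner : ∀ {x y} → .(x < M ⊎ y < M) → x < M ⊎ y < M
  recomputeNotCorner {x} {y} = recompute ((x <? M) ⊎-dec (y <? M))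

  0<M : 0 < M
  0<M = s≤s z≤n

  M≮M : ¬ M < M
  M≮M = n≮n M

  p∸<M : ∀ y → p ∸ y < M
  p∸<M y = s≤s (m∸n≤m p y)

  p∸≤M : ∀ y → p ∸ y ≤ M
  p∸≤M y = <⇒≤ (p∸<M y)

  p∸[p∸y]≡y : ∀ {y} → y < M → p ∸ (p ∸ y) ≡ y
  p∸[p∸y]≡y y<M = m∸[m∸n]≡n (≤-pred y<M)

  suc[p∸y]≡M∸y : ∀ {y} → y < M → suc (p ∸ y) ≡ M ∸ y
  suc[p∸y]≡M∸y y<M = sym (+-∸-assoc 1 (≤-pred y<M))

  M∸[p∸y]≡suc-y : ∀ {y} → y < M → M ∸ (p ∸ y) ≡ suc y
  M∸[p∸y]≡suc-y {y} y<M = trans (+-∸-assoc 1 (m∸n≤m p y)) (cong suc (p∸[p∸y]≡y y<M))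

  [0,p∸p]≡[p∸p,0] : (0 , p ∸ p) ≡ (p ∸ p , 0)
  [0,p∸p]≡[p∸p,0] = cong₂ _,_ (sym (n∸n≡0 p)) (n∸n≡0 p)

  ≮M⇒≡M : ∀ {x} → x ≤ M → ¬ x < M → x ≡ M
  ≮M⇒≡M x≤M x≮M = ≤-antisym x≤M (≮⇒≥ x≮M)

  M,M-isCorner : ¬ (M < M ⊎ M < M)
  M,M-isCorner (inj₁ M<M) = M≮M M<M
  M,M-isCorner (inj₂ M<M) = M≮M M<M

  other<M : ∀ {x y} → x < M ⊎ y < M → ¬ x < M → y < M
  other<M (inj₁ x<M) x≮M = contradiction x<M x≮M
  other<M (inj₂ y<M) _   = y<M

  -- The right side of cell (p , M) and the top side of cell (M , p) are both the edge from (M , M) to (0 , 0).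
  Special : ℕ → ℕ → Set
  Special x y = x ≡ p × y ≡ M

  special? : ∀ x y → Dec (Special x y)
  special? x y = (x ≟ p) ×-dec (y ≟ M)

  notCorner-suc : ∀ {x y} → x < M → ¬ Special x y → y ≤ M → suc x < M ⊎ y < M
  notCorner-suc {x} {y} x<M ns y≤M with y <? M | x ≟ p
  ... | yes y<M | _       = inj₂ y<M
  ... | no y≮M  | yes x≡p = contradiction (x≡p , ≮M⇒≡M y≤M y≮M) ns
  ... | no _    | no x≢p  = inj₁ (s≤s (≤∧≢⇒< (≤-pred x<M) x≢p))

  Glued : Set
  Glued = Cell × Side × Bool

  -- glue c d: the cell and side across side d of c, and whether the two sides run in opposite
  -- directions (they do, except across the twisted sides).
  glue : Cell → Side → Glued
  glue (cell x y x≤M y≤M nc) right with special? x y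
  ... | yes _ = cell M p ≤-refl (n≤1+n p) (inj₂ ≤-refl) , top , true
  ... | no ns with x <? M
  ...   | yes x<M = cell (suc x) y x<M y≤M (notCorner-suc x<M ns (recompute≤ y≤M)) , left , true
  ...   | no _    = cell 0 (p ∸ y) z≤n (p∸≤M y) (inj₁ 0<M) , left , false
  glue (cell zero y x≤M y≤M nc) left with y ≟ M
  ... | yes _ = cell M 0 ≤-refl z≤n (inj₂ 0<M) , bottom , false
  ... | no _  = cell M (p ∸ y) ≤-refl (p∸≤M y) (inj₂ (p∸<M y)) , right , false
  glue (cell (suc x) y x≤M y≤M nc) left = cell x y (≤-trans (n≤1+n x) x≤M) y≤M (inj₁ x≤M) , right , true
  glue (cell x y x≤M y≤M nc) top with special? y x
  ... | yes _ = cell p M (n≤1+n p) ≤-refl (inj₁ ≤-refl) , right , true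
  ... | no ns with y <? M
  ...   | yes y<M = cell x (suc y) x≤M y<M (swap (notCorner-suc y<M ns (recompute≤ x≤M))) , bottom , true
  ...   | no _    = cell (p ∸ x) 0 (p∸≤M x) z≤n (inj₂ 0<M) , bottom , false
  glue (cell x zero x≤M y≤M nc) bottom with x ≟ M
  ... | yes _ = cell 0 M z≤n ≤-refl (inj₁ 0<M) , left , false
  ... | no _  = cell (p ∸ x) M (p∸≤M x) ≤-refl (inj₁ (p∸<M x)) , top , false
  glue (cell x (suc y) x≤M y≤M nc) bottom = cell x y x≤M (≤-trans (n≤1+n y) y≤M) (inj₂ y≤M) , top , true

  τ₂ : Flag → Flag
  τ₂ (flag c d t) = let (c′ , d′ , o) = glue c d in flag c′ d′ (o xor t)

  GluesBack : Cell → Side → Set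
  GluesBack c d = let (c′ , d′ , o) = glue c d in glue c′ d′ ≡ (c , d , o)

  glue-right-back : ∀ c → GluesBack c right
  glue-right-back (cell x y x≤M y≤M nc) with special? x y
  ... | yes (refl , refl) with special? p M
  ...   | yes _ = refl
  ...   | no ns = contradiction (refl , refl) ns
  glue-right-back (cell x y x≤M y≤M nc) | no _ with x <? M
  ... | yes _   = refl
  ... | no x≮M with p ∸ y ≟ M
  ...   | yes eq = contradiction eq (<⇒≢ (p∸<M y))
  ...   | no _   = cong (_, right , false)
                     (cell-cong (sym (≮M⇒≡M (recompute≤ x≤M) x≮M)) (p∸[p∸y]≡y (other<M (recomputeNotCorner nc) x≮M)))

  glue-left-back : ∀ c → GluesBack c left
  glue-left-back (cell zero y x≤M y≤M nc) with y ≟ M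
  ... | yes refl with M ≟ M
  ...   | yes _  = refl
  ...   | no M≢M = contradiction refl M≢M
  glue-left-back (cell zero y x≤M y≤M nc) | no y≢M with special? M (p ∸ y)
  ... | yes (M≡p , _) = contradiction M≡p (<⇒≢ ≤-refl ∘ sym)
  ... | no _ with M <? M
  ...   | yes M<M = contradiction M<M M≮M
  ...   | no _    = cong (_, left , false) (cell-cong refl (p∸[p∸y]≡y (≤∧≢⇒< (recompute≤ y≤M) y≢M)))
  glue-left-back (cell (suc x) y x≤M y≤M nc) with special? x y
  ... | yes (refl , refl) = Irrelevant.⊥-elim (M,M-isCorner nc)
  ... | no _ with x <? M
  ...   | yes _   = refl
  ...   | no x≮M = contradiction (recompute≤ x≤M) x≮M

  glue-top-back : ∀ c → GluesBack c top
  glue-top-back (cell x y x≤M y≤M nc) with special? y x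
  ... | yes (refl , refl) with special? p M
  ...   | yes _ = refl
  ...   | no ns = contradiction (refl , refl) ns
  glue-top-back (cell x y x≤M y≤M nc) | no _ with y <? M
  ... | yes _   = refl
  ... | no y≮M with p ∸ x ≟ M
  ...   | yes eq = contradiction eq (<⇒≢ (p∸<M x))
  ...   | no _   = cong (_, top , false)
                     (cell-cong (p∸[p∸y]≡y (other<M (swap (recomputeNotCorner nc)) y≮M)) (sym (≮M⇒≡M (recompute≤ y≤M) y≮M)))

  glue-bottom-back : ∀ c → GluesBack c bottom
  glue-bottom-back (cell x zero x≤M y≤M nc) with x ≟ M
  ... | yes refl with M ≟ M
  ...   | yes _  = refl
  ...   | no M≢M = contradiction refl M≢M
  glue-bottom-back (cell x zero x≤M y≤M nc) | no x≢M with special? M (p ∸ x)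
  ... | yes (M≡p , _) = contradiction M≡p (<⇒≢ ≤-refl ∘ sym)
  ... | no _ with M <? M
  ...   | yes M<M = contradiction M<M M≮M
  ...   | no _    = cong (_, bottom , false) (cell-cong (p∸[p∸y]≡y (≤∧≢⇒< (recompute≤ x≤M) x≢M)) refl)
  glue-bottom-back (cell x (suc y) x≤M y≤M nc) with special? y x
  ... | yes (refl , refl) = Irrelevant.⊥-elim (M,M-isCorner nc)
  ... | no _ with y <? M
  ...   | yes _   = refl
  ...   | no y≮M = contradiction (recompute≤ y≤M) y≮M

  glue-back : ∀ c d → GluesBack c d
  glue-back c bottom = glue-bottom-back c
  glue-back c right  = glue-right-back c
  glue-back c top    = glue-top-back c
  glue-back c left   = glue-left-back c

  glue-moves-side : ∀ c d → proj₁ (proj₂ (glue c d)) ≢ d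
  glue-moves-side (cell x y _ _ _) right with special? x y
  ... | yes _ = λ ()
  ... | no _ with x <? M
  ...   | yes _ = λ ()
  ...   | no _  = λ ()
  glue-moves-side (cell zero y _ _ _) left with y ≟ M
  ... | yes _ = λ ()
  ... | no _  = λ ()
  glue-moves-side (cell (suc x) y _ _ _) left = λ ()
  glue-moves-side (cell x y _ _ _) top with special? y x
  ... | yes _ = λ ()
  ... | no _ with y <? M
  ...   | yes _ = λ ()
  ...   | no _  = λ ()
  glue-moves-side (cell x zero _ _ _) bottom with x ≟ M
  ... | yes _ = λ ()
  ... | no _  = λ ()
  glue-moves-side (cell x (suc y) _ _ _) bottom = λ ()

  τ₀-fpfInvolution : IsFPFInvolution τ₀
  τ₀-fpfInvolution = involutive , fpf
    where
    involutive : ∀ q → τ₀ (τ₀ q) ≡ q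
    involutive (flag c d t) = cong (flag c d) (not-involutive t)
    fpf : ∀ q → τ₀ q ≢ q
    fpf (flag c d false) ()
    fpf (flag c d true)  ()

  τ₁-fpfInvolution : IsFPFInvolution τ₁
  τ₁-fpfInvolution = involutive , fpf
    where
    involutive : ∀ q → τ₁ (τ₁ q) ≡ q
    involutive (flag c d false) = cong (λ d′ → flag c d′ false) (next-prev d)
    involutive (flag c d true)  = cong (λ d′ → flag c d′ true) (prev-next d)
    fpf : ∀ q → τ₁ q ≢ q
    fpf (flag c d false) ()
    fpf (flag c d true)  ()

  τ₂-fpfInvolution : IsFPFInvolution τ₂
  τ₂-fpfInvolution = involutive , fpf
    where
    involutive : ∀ q → τ₂ (τ₂ q) ≡ q
    involutive (flag c d t) rewrite glue-back c d = cong (flag c d) (xor-cancelˡ (proj₂ (proj₂ (glue c d))) t)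
    fpf : ∀ q → τ₂ q ≢ q
    fpf (flag c d t) eq = glue-moves-side c d (cong Flag.side eq)

  τ₀τ₂-comm : ∀ q → τ₀ (τ₂ q) ≡ τ₂ (τ₀ q)
  τ₀τ₂-comm (flag c d t) = cong (flag _ _) (not-distribʳ-xor (proj₂ (proj₂ (glue c d))) t)

  τ₀τ₂-fpf : ∀ q → τ₀ (τ₂ q) ≢ q
  τ₀τ₂-fpf (flag c d t) eq = glue-moves-side c d (cong Flag.side eq)

  face4 : ∀ q → iter 4 (τ₀ ∘ τ₁) q ≡ q
  face4 (flag c bottom false) = refl
  face4 (flag c right false)  = refl
  face4 (flag c top false)    = refl
  face4 (flag c left false)   = refl
  face4 (flag c bottom true)  = refl
  face4 (flag c right true)   = refl
  face4 (flag c top true)     = refl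
  face4 (flag c left true)    = refl

  face-not2 : ∀ q → iter 2 (τ₀ ∘ τ₁) q ≢ q
  face-not2 (flag c bottom false) ()
  face-not2 (flag c right false)  ()
  face-not2 (flag c top false)    ()
  face-not2 (flag c left false)   ()
  face-not2 (flag c bottom true)  ()
  face-not2 (flag c right true)   ()
  face-not2 (flag c top true)     ()
  face-not2 (flag c left true)    ()

  rightOf above : ℕ → ℕ → ℕ × ℕ
  rightOf x y with x <? M
  ... | yes _ = suc x , y
  ... | no _  = 0 , M ∸ y
  above x y with y <? M
  ... | yes _ = x , suc y
  ... | no _  = M ∸ x , 0

  -- the vertex at which side d of cell c starts
  corner : Cell → Side → ℕ × ℕ
  corner (cell x y _ _ _) bottom = x , y
  corner (cell x y _ _ _) right  = rightOf x y
  corner (cell x y _ _ _) top with x <? M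
  ... | yes _ = above (suc x) y
  ... | no _  = rightOf x (suc y)
  corner (cell x y _ _ _) left   = above x y

  flagCorner : Flag → ℕ × ℕ
  flagCorner (flag c d false) = corner c d
  flagCorner (flag c d true)  = corner c (next d)

  rightOf-< : ∀ {x y} → x < M → rightOf x y ≡ (suc x , y)
  rightOf-< {x} x<M with x <? M
  ... | yes _  = refl
  ... | no x≮M = contradiction x<M x≮M

  rightOf-≮ : ∀ {x y} → ¬ x < M → rightOf x y ≡ (0 , M ∸ y)
  rightOf-≮ {x} x≮M with x <? M
  ... | yes x<M = contradiction x<M x≮M
  ... | no _    = refl

  above-< : ∀ {x y} → y < M → above x y ≡ (x , suc y)
  above-< {y = y} y<M with y <? M
  ... | yes _  = refl
  ... | no y≮M = contradiction y<M y≮M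

  above-≮ : ∀ {x y} → ¬ y < M → above x y ≡ (M ∸ x , 0)
  above-≮ {y = y} y≮M with y <? M
  ... | yes y<M = contradiction y<M y≮M
  ... | no _    = refl

  module _ {x y : ℕ} .{x≤M : x ≤ M} .{y≤M : y ≤ M} .{nc : x < M ⊎ y < M} where
    top-< : x < M → corner (cell x y x≤M y≤M nc) top ≡ above (suc x) y
    top-< x<M with x <? M
    ... | yes _  = refl
    ... | no x≮M = contradiction x<M x≮M

    top-≮ : ¬ x < M → corner (cell x y x≤M y≤M nc) top ≡ (0 , p ∸ y)
    top-≮ x≮M with x <? M
    ... | yes x<M = contradiction x<M x≮M
    ... | no _    = rightOf-≮ x≮M

  τ₁-corner : ∀ q → flagCorner (τ₁ q) ≡ flagCorner q
  τ₁-corner (flag c d true)  = refl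
  τ₁-corner (flag c d false) = cong (corner c) (next-prev d)

  top≡rightOf-above : ∀ {x y} .{x≤M y≤M nc} → y < M → corner (cell x y x≤M y≤M nc) top ≡ rightOf x (suc y)
  top≡rightOf-above {x} y<M with x <? M
  ... | yes _   = above-< y<M
  ... | no x≮M  = rightOf-≮ x≮M

  τ₂-corner-right : ∀ c t → flagCorner (τ₂ (flag c right t)) ≡ flagCorner (flag c right t)
  τ₂-corner-right (cell x y x≤M y≤M nc) t with special? x y
  τ₂-corner-right (cell x y x≤M y≤M nc) false | yes (refl , refl) = trans (above-< ≤-refl) (sym (rightOf-< ≤-refl))
  τ₂-corner-right (cell x y x≤M y≤M nc) true  | yes (refl , refl) =
    trans (top-≮ M≮M) (trans [0,p∸p]≡[p∸p,0] (sym (trans (top-< ≤-refl) (above-≮ M≮M))))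
  τ₂-corner-right (cell x y x≤M y≤M nc) t | no _ with x <? M
  τ₂-corner-right (cell x y x≤M y≤M nc) false | no _ | yes x<M = sym (rightOf-< x<M)
  τ₂-corner-right (cell x y x≤M y≤M nc) true  | no _ | yes x<M = sym (top-< x<M)
  τ₂-corner-right (cell x y x≤M y≤M nc) false | no _ | no x≮M =
    trans (above-< (p∸<M y)) (trans (cong (0 ,_) (suc[p∸y]≡M∸y (other<M (recomputeNotCorner nc) x≮M))) (sym (rightOf-≮ x≮M)))
  τ₂-corner-right (cell x y x≤M y≤M nc) true  | no _ | no x≮M = sym (top-≮ x≮M)

  τ₂-corner-left : ∀ c t → flagCorner (τ₂ (flag c left t)) ≡ flagCorner (flag c left t)
  τ₂-corner-left (cell zero y x≤M y≤M nc) t with y ≟ M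
  τ₂-corner-left (cell zero y x≤M y≤M nc) false | yes refl = sym (above-≮ M≮M)
  τ₂-corner-left (cell zero y x≤M y≤M nc) true  | yes refl = rightOf-≮ M≮M
  τ₂-corner-left (cell zero y x≤M y≤M nc) false | no y≢M =
    trans (rightOf-≮ M≮M) (trans (cong (0 ,_) (M∸[p∸y]≡suc-y y<M)) (sym (above-< y<M)))
    where
    y<M : y < M
    y<M = ≤∧≢⇒< (recompute≤ y≤M) y≢M
  τ₂-corner-left (cell zero y x≤M y≤M nc) true  | no y≢M =
    trans (top-≮ M≮M) (cong (0 ,_) (p∸[p∸y]≡y (≤∧≢⇒< (recompute≤ y≤M) y≢M)))
  τ₂-corner-left (cell (suc x) y x≤M y≤M nc) false = top-< (recompute≤ x≤M)
  τ₂-corner-left (cell (suc x) y x≤M y≤M nc) true  = rightOf-< (recompute≤ x≤M)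

  τ₂-corner-top : ∀ c t → flagCorner (τ₂ (flag c top t)) ≡ flagCorner (flag c top t)
  τ₂-corner-top (cell x y x≤M y≤M nc) t with special? y x
  τ₂-corner-top (cell x y x≤M y≤M nc) false | yes (refl , refl) =
    trans (top-< ≤-refl) (trans (above-≮ M≮M) (sym (trans (top-≮ M≮M) [0,p∸p]≡[p∸p,0])))
  τ₂-corner-top (cell x y x≤M y≤M nc) true  | yes (refl , refl) = trans (rightOf-< ≤-refl) (sym (above-< ≤-refl))
  τ₂-corner-top (cell x y x≤M y≤M nc) t | no _ with y <? M
  τ₂-corner-top (cell x y x≤M y≤M nc) false | no _ | yes y<M = sym (top≡rightOf-above y<M)
  τ₂-corner-top (cell x y x≤M y≤M nc) true  | no _ | yes y<M = sym (above-< y<M)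
  τ₂-corner-top (cell x y x≤M y≤M nc) false | no _ | no y≮M =
    sym (trans (top-< x<M) (above-≮ y≮M))
    where
    x<M : x < M
    x<M = other<M (swap (recomputeNotCorner nc)) y≮M
  τ₂-corner-top (cell x y x≤M y≤M nc) true  | no _ | no y≮M =
    trans (rightOf-< (p∸<M x)) (trans (cong (_, 0) (suc[p∸y]≡M∸y x<M)) (sym (above-≮ y≮M)))
    where
    x<M : x < M
    x<M = other<M (swap (recomputeNotCorner nc)) y≮M

  τ₂-corner-bottom : ∀ c t → flagCorner (τ₂ (flag c bottom t)) ≡ flagCorner (flag c bottom t)
  τ₂-corner-bottom (cell x zero x≤M y≤M nc) t with x ≟ M
  τ₂-corner-bottom (cell x zero x≤M y≤M nc) false | yes refl = above-≮ M≮M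
  τ₂-corner-bottom (cell x zero x≤M y≤M nc) true  | yes refl = sym (rightOf-≮ M≮M)
  τ₂-corner-bottom (cell x zero x≤M y≤M nc) false | no x≢M =
    trans (top-< (p∸<M x)) (trans (above-≮ M≮M) (cong (_, 0) (p∸[p∸y]≡y (≤∧≢⇒< (recompute≤ x≤M) x≢M))))
  τ₂-corner-bottom (cell x zero x≤M y≤M nc) true  | no x≢M =
    trans (above-≮ M≮M) (trans (cong (_, 0) (M∸[p∸y]≡suc-y x<M)) (sym (rightOf-< x<M)))
    where
    x<M : x < M
    x<M = ≤∧≢⇒< (recompute≤ x≤M) x≢M
  τ₂-corner-bottom (cell x (suc y) x≤M y≤M nc) false = above-< (recompute≤ y≤M)
  τ₂-corner-bottom (cell x (suc y) x≤M y≤M nc) true  = top≡rightOf-above (recompute≤ y≤M)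

  τ₂-corner : ∀ q → flagCorner (τ₂ q) ≡ flagCorner q
  τ₂-corner (flag c bottom t) = τ₂-corner-bottom c t
  τ₂-corner (flag c right t)  = τ₂-corner-right c t
  τ₂-corner (flag c top t)    = τ₂-corner-top c t
  τ₂-corner (flag c left t)   = τ₂-corner-left c t

  module _ {x y : ℕ} .{x≤M : x ≤ M} .{y≤M : y ≤ M} .{nc : x < M ⊎ y < M} where
    glue-right-< : (ns : ¬ Special x y) (x<M : x < M) →
                   glue (cell x y x≤M y≤M nc) right ≡ (cell (suc x) y x<M y≤M (notCorner-suc x<M ns (recompute≤ y≤M)) , left , true)
    glue-right-< ns x<M with special? x y
    ... | yes s = contradiction s ns
    ... | no _ with x <? M
    ...   | yes _  = refl
    ...   | no x≮M = contradiction x<M x≮M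

    glue-right-≮ : ¬ x < M → glue (cell x y x≤M y≤M nc) right ≡ (cell 0 (p ∸ y) z≤n (p∸≤M y) (inj₁ 0<M) , left , false)
    glue-right-≮ x≮M with special? x y
    ... | yes (refl , _) = contradiction ≤-refl x≮M
    ... | no _ with x <? M
    ...   | yes x<M = contradiction x<M x≮M
    ...   | no _    = refl

    glue-top-< : (ns : ¬ Special y x) (y<M : y < M) →
                 glue (cell x y x≤M y≤M nc) top ≡ (cell x (suc y) x≤M y<M (swap (notCorner-suc y<M ns (recompute≤ x≤M))) , bottom , true)
    glue-top-< ns y<M with special? y x
    ... | yes s = contradiction s ns
    ... | no _ with y <? M
    ...   | yes _  = refl
    ...   | no y≮M = contradiction y<M y≮M

    glue-top-≮ : ¬ y < M → glue (cell x y x≤M y≤M nc) top ≡ (cell (p ∸ x) 0 (p∸≤M x) z≤n (inj₂ 0<M) , bottom , false)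
    glue-top-≮ y≮M with special? y x
    ... | yes (refl , _) = contradiction ≤-refl y≮M
    ... | no _ with y <? M
    ...   | yes y<M = contradiction y<M y≮M
    ...   | no _    = refl

  module _ .{a : p ≤ M} .{b : M ≤ M} .{nc : p < M ⊎ M < M} where
    glue-right-special : glue (cell p M a b nc) right ≡ (cell M p ≤-refl (n≤1+n p) (inj₂ ≤-refl) , top , true)
    glue-right-special with special? p M
    ... | yes _ = refl
    ... | no ns = contradiction (refl , refl) ns

  module _ .{a : M ≤ M} .{b : p ≤ M} .{nc : M < M ⊎ p < M} where
    glue-top-special : glue (cell M p a b nc) top ≡ (cell p M (n≤1+n p) ≤-refl (inj₁ ≤-refl) , right , true)
    glue-top-special with special? p M
    ... | yes _ = refl
    ... | no ns = contradiction (refl , refl) ns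

  cornerFlag : Flag
  cornerFlag = flag (cell p M (n≤1+n p) ≤-refl (inj₁ ≤-refl)) right false

  -- The flag from which the vertex orbit of a grid vertex is reached: the lower left flag of its cell,
  -- or cornerFlag for (M , M), which has no cell. Points outside the grid also get cornerFlag (junk).
  canonical : ℕ × ℕ → Flag
  canonical (a , b) with a ≤? M | b ≤? M | (a <? M) ⊎-dec (b <? M)
  ... | yes a≤M | yes b≤M | yes nc = flag (cell a b a≤M b≤M nc) bottom false
  ... | _       | _       | _      = cornerFlag

  canonical-cell : ∀ {a b} .{a≤M b≤M} (nc : a < M ⊎ b < M) → canonical (a , b) ≡ flag (cell a b a≤M b≤M nc) bottom false
  canonical-cell {a} {b} {a≤M} {b≤M} nc with a ≤? M | b ≤? M | (a <? M) ⊎-dec (b <? M)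
  ... | yes _ | yes _ | yes _  = refl
  ... | no a≰M | _    | _      = Irrelevant.⊥-elim (a≰M a≤M)
  ... | yes _ | no b≰M | _     = Irrelevant.⊥-elim (b≰M b≤M)
  ... | yes _ | yes _ | no ¬nc = contradiction nc ¬nc

  canonical-M,M : canonical (M , M) ≡ cornerFlag
  canonical-M,M with M ≤? M
  ... | no _ = refl
  ... | yes _ with (M <? M) ⊎-dec (M <? M)
  ...   | yes nc = contradiction nc M,M-isCorner
  ...   | no _   = refl

  data IsCanonical : Flag → Set where
    cell-origin : ∀ {c} → IsCanonical (flag c bottom false)
    corner-M,M  : ∀ .{a b nc} → IsCanonical (flag (cell p M a b nc) right false)

  canonical-flagCorner : ∀ {r} → IsCanonical r → canonical (flagCorner r) ≡ r
  canonical-flagCorner {flag (cell x y x≤M y≤M nc) bottom false} cell-origin = canonical-cell (recomputeNotCorner nc)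
  canonical-flagCorner corner-M,M = trans (cong canonical (rightOf-< ≤-refl)) canonical-M,M

  VertexStep : Flag → Flag → Set
  VertexStep = Step₂ τ₁ τ₂

  CanonicalPath : Flag → Set
  CanonicalPath q = ∃ λ r → Star VertexStep q r × IsCanonical r

  viaτ₁ : ∀ {q} → CanonicalPath (τ₁ q) → CanonicalPath q
  viaτ₁ (r , path , can) = r , inj₁ refl ◅ path , can

  viaτ₂ : ∀ {c d t c′ d′ o} → glue c d ≡ (c′ , d′ , o) → CanonicalPath (flag c′ d′ (o xor t)) → CanonicalPath (flag c d t)
  viaτ₂ {t = t} eq (r , path , can) = r , inj₂ (cong (λ (c′ , d′ , o) → flag c′ d′ (o xor t)) (sym eq)) ◅ path , can

  done : ∀ {r} → IsCanonical r → CanonicalPath r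
  done can = _ , ε , can

  fromRightCorner : ∀ c → CanonicalPath (flag c right false)
  fromRightCorner (cell x y x≤M y≤M nc) with special? x y
  ... | yes (refl , refl) = done corner-M,M
  ... | no ns with x <? M
  ...   | yes x<M = viaτ₂ (glue-right-< ns x<M) (viaτ₁ (done cell-origin))
  ...   | no x≮M  = viaτ₂ (glue-right-≮ x≮M) (viaτ₁ (viaτ₂ (glue-top-< ns′ (p∸<M y)) (done cell-origin)))
    where
    ns′ : ¬ Special (p ∸ y) 0
    ns′ ()

  fromLeftCorner : ∀ c → CanonicalPath (flag c top true)
  fromLeftCorner (cell x y x≤M y≤M nc) with special? y x
  ... | yes (refl , refl) = viaτ₂ glue-top-special (done corner-M,M)
  ... | no ns with y <? M
  ...   | yes y<M = viaτ₂ (glue-top-< ns y<M) (done cell-origin)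
  ...   | no y≮M  = viaτ₂ (glue-top-≮ y≮M) (viaτ₁ (fromRightCorner _))

  fromTopCorner : ∀ c → CanonicalPath (flag c right true)
  fromTopCorner (cell x y x≤M y≤M nc) with special? x y
  ... | yes (refl , refl) = viaτ₂ glue-right-special (viaτ₁ (viaτ₂ (glue-right-≮ M≮M) (viaτ₁ (done cell-origin))))
  ... | no ns with x <? M
  ...   | yes x<M = viaτ₂ (glue-right-< ns x<M) (viaτ₁ (fromLeftCorner _))
  ...   | no x≮M  = viaτ₂ (glue-right-≮ x≮M) (viaτ₁ (done cell-origin))

  canonicalPath : ∀ q → CanonicalPath q
  canonicalPath (flag c bottom false) = done cell-origin
  canonicalPath (flag c left true)    = viaτ₁ (done cell-origin)
  canonicalPath (flag c right false)  = fromRightCorner c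
  canonicalPath (flag c bottom true)  = viaτ₁ (fromRightCorner c)
  canonicalPath (flag c right true)   = fromTopCorner c
  canonicalPath (flag c top false)    = viaτ₁ (fromTopCorner c)
  canonicalPath (flag c top true)     = fromLeftCorner c
  canonicalPath (flag c left false)   = viaτ₁ (fromLeftCorner c)

  flagCorner-invariant : ∀ {q r} → Star VertexStep q r → flagCorner r ≡ flagCorner q
  flagCorner-invariant ε                    = refl
  flagCorner-invariant {q} (inj₁ refl ◅ path) = trans (flagCorner-invariant path) (τ₁-corner q)
  flagCorner-invariant {q} (inj₂ refl ◅ path) = trans (flagCorner-invariant path) (τ₂-corner q)

  toCanonical : ∀ q → Star VertexStep q (canonical (flagCorner q))
  toCanonical q with canonicalPath q
  ... | r , path , can = subst (Star VertexStep q) (trans (sym (canonical-flagCorner can)) (cong canonical (flagCorner-invariant path))) path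

  sameCorner⇒vertexOrbit : ∀ q r → flagCorner q ≡ flagCorner r → Star VertexStep q r
  sameCorner⇒vertexOrbit q r eq =
    toCanonical q ◅◅ subst (λ v → Star VertexStep (canonical v) r) (sym eq)
                           (reverse (Step₂-sym τ₁-fpfInvolution τ₂-fpfInvolution) (toCanonical r))

  MapStep : Flag → Flag → Set
  MapStep = Step₃ τ₀ τ₁ τ₂

  MapStep-sym : ∀ {q r} → MapStep q r → MapStep r q
  MapStep-sym = Step₃-sym τ₀-fpfInvolution τ₁-fpfInvolution τ₂-fpfInvolution

  toCanonical₃ : ∀ q → Star MapStep q (canonical (flagCorner q))
  toCanonical₃ q = map (Step₂⇒Step₃ {σ = τ₀} {τ₁} {τ₂}) (toCanonical q)

  acrossEdge : ∀ q → Star MapStep (canonical (flagCorner q)) (canonical (flagCorner (τ₀ q)))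
  acrossEdge q = reverse MapStep-sym (toCanonical₃ q) ◅◅ inj₁ refl ◅ toCanonical₃ (τ₀ q)

  InGrid : ℕ × ℕ → Set
  InGrid (a , b) = a ≤ M × b ≤ M

  toOrigin : ∀ v → InGrid v → Star MapStep (canonical v) (canonical (0 , 0))
  toOrigin (zero  , zero)  _           = ε
  toOrigin (suc a , b)     (a<M , b≤M) =
    subst (λ v → Star MapStep (canonical v) (canonical (a , b))) (rightOf-< a<M) (acrossEdge (flag (cell a b (<⇒≤ a<M) b≤M (inj₁ a<M)) bottom true))
    ◅◅ toOrigin (a , b) (<⇒≤ a<M , b≤M)
  toOrigin (zero  , suc b) (_ , b<M)   =
    subst (λ v → Star MapStep (canonical v) (canonical (0 , b))) (above-< b<M) (acrossEdge (flag (cell 0 b z≤n (<⇒≤ b<M) (inj₁ 0<M)) left false))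
    ◅◅ toOrigin (0 , b) (z≤n , <⇒≤ b<M)

  rightOf-inGrid : ∀ {x y} → x ≤ M → y ≤ M → InGrid (rightOf x y)
  rightOf-inGrid {x} {y} x≤M y≤M with x <? M
  ... | yes x<M = x<M , y≤M
  ... | no _    = z≤n , m∸n≤m M y

  above-inGrid : ∀ {x y} → x ≤ M → y ≤ M → InGrid (above x y)
  above-inGrid {x} {y} x≤M y≤M with y <? M
  ... | yes y<M = x≤M , y<M
  ... | no _    = m∸n≤m M x , z≤n

  corner-inGrid : ∀ c d → InGrid (corner c d)
  corner-inGrid (cell x y x≤M y≤M nc) bottom = recompute≤ x≤M , recompute≤ y≤M
  corner-inGrid (cell x y x≤M y≤M nc) right  = rightOf-inGrid (recompute≤ x≤M) (recompute≤ y≤M)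
  corner-inGrid (cell x y x≤M y≤M nc) left   = above-inGrid (recompute≤ x≤M) (recompute≤ y≤M)
  corner-inGrid (cell x y x≤M y≤M nc) top with x <? M
  ... | yes x<M = above-inGrid x<M (recompute≤ y≤M)
  ... | no x≮M  = rightOf-inGrid (recompute≤ x≤M) (other<M (recomputeNotCorner nc) x≮M)

  flagCorner-inGrid : ∀ q → InGrid (flagCorner q)
  flagCorner-inGrid (flag c d false) = corner-inGrid c d
  flagCorner-inGrid (flag c d true)  = corner-inGrid c (next d)

  connected : ∀ q r → Star MapStep q r
  connected q r =
    toCanonical₃ q ◅◅ toOrigin _ (flagCorner-inGrid q) ◅◅
    reverse MapStep-sym (toCanonical₃ r ◅◅ toOrigin _ (flagCorner-inGrid r))

  toℕ-mod : ∀ {a} → a < K → toℕ (a mod K) ≡ a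
  toℕ-mod a<K = trans (toℕ-fromℕ< _) (m<n⇒m%n≡m a<K)

  -- reducing modulo K only makes vertex total; it is the identity on the grid
  vertex : ℕ × ℕ → Fin (K * K)
  vertex (a , b) = combine (b mod K) (a mod K)

  coordinates : Fin (K * K) → ℕ × ℕ
  coordinates v = let (Y , X) = remQuot {K} K v in toℕ X , toℕ Y

  coordinates-inGrid : ∀ v → InGrid (coordinates v)
  coordinates-inGrid v = let (Y , X) = remQuot {K} K v in toℕ≤pred[n] X , toℕ≤pred[n] Y

  vertex-coordinates : ∀ v → vertex (coordinates v) ≡ v
  vertex-coordinates v = let (Y , X) = remQuot {K} K v in
    trans (cong₂ combine (toℕ-injective (toℕ-mod (toℕ<n Y))) (toℕ-injective (toℕ-mod (toℕ<n X)))) (combine-remQuot {K} K v)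

  vertex-injective : ∀ {v w} → InGrid v → InGrid w → vertex v ≡ vertex w → v ≡ w
  vertex-injective {a , b} {a′ , b′} (a≤M , b≤M) (a′≤M , b′≤M) eq =
    let (Y≡Y′ , X≡X′) = combine-injective (b mod K) (a mod K) (b′ mod K) (a′ mod K) eq in
    cong₂ _,_ (mod-injective a≤M a′≤M X≡X′) (mod-injective b≤M b′≤M Y≡Y′)
    where
    mod-injective : ∀ {a a′} → a ≤ M → a′ ≤ M → a mod K ≡ a′ mod K → a ≡ a′
    mod-injective a≤M a′≤M eq = trans (sym (toℕ-mod (s≤s a≤M))) (trans (cong toℕ eq) (toℕ-mod (s≤s a′≤M)))

  flagCorner-canonical : ∀ {v} → InGrid v → flagCorner (canonical v) ≡ v
  flagCorner-canonical {a , b} (a≤M , b≤M) = by-cases ((a <? M) ⊎-dec (b <? M))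
    where
    open ≡-Reasoning
    by-cases : Dec (a < M ⊎ b < M) → flagCorner (canonical (a , b)) ≡ (a , b)
    by-cases (yes nc) = cong flagCorner (canonical-cell {a≤M = a≤M} {b≤M} nc)
    by-cases (no ¬nc) = begin
      flagCorner (canonical (a , b)) ≡⟨ cong (flagCorner ∘ canonical) a,b≡M,M ⟩
      flagCorner (canonical (M , M)) ≡⟨ cong flagCorner canonical-M,M ⟩
      rightOf p M                    ≡⟨ rightOf-< ≤-refl ⟩
      (M , M)                        ≡⟨ a,b≡M,M ⟨
      (a , b)                        ∎
      where
      a,b≡M,M : (a , b) ≡ (M , M)
      a,b≡M,M = cong₂ _,_ (≮M⇒≡M a≤M (¬nc ∘ inj₁)) (≮M⇒≡M b≤M (¬nc ∘ inj₂))

  vtx : Flag → Fin (K * K)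
  vtx = vertex ∘ flagCorner

  vtx-surjective : Surjective _≡_ _≡_ vtx
  vtx-surjective v = canonical (coordinates v) , λ { refl →
    trans (cong vertex (flagCorner-canonical (coordinates-inGrid v))) (vertex-coordinates v) }

  vtx-orbit : ∀ q r → vtx q ≡ vtx r → Star VertexStep q r
  vtx-orbit q r eq = sameCorner⇒vertexOrbit q r (vertex-injective (flagCorner-inGrid q) (flagCorner-inGrid r) eq)

  -- K * K reduces to suc f, and the extra index is that of vertex (M , M), the corner without a cell.
  f : ℕ
  f = M + M * K

  toℕ-vertex-M,M : toℕ (vertex (M , M)) ≡ f
  toℕ-vertex-M,M = begin
    toℕ (vertex (M , M))                       ≡⟨ toℕ-combine (M mod K) (M mod K) ⟩
    K * toℕ (M mod K) + toℕ (M mod K)          ≡⟨ cong₂ (λ a b → K * a + b) (toℕ-mod ≤-refl) (toℕ-mod ≤-refl) ⟩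
    K * M + M                                  ≡⟨ +-comm (K * M) M ⟩
    M + K * M                                  ≡⟨ cong (M +_) (*-comm K M) ⟩
    f                                          ∎
    where open ≡-Reasoning

  coordinates-vertex : ∀ {w} → InGrid w → coordinates (vertex w) ≡ w
  coordinates-vertex {w} w∈ = vertex-injective (coordinates-inGrid (vertex w)) w∈ (vertex-coordinates (vertex w))

  cellIndex : Cell → Fin f
  cellIndex (cell x y x≤M y≤M nc) = lower₁ (vertex (x , y)) not-last
    where
    not-last : f ≢ toℕ (vertex (x , y))
    not-last eq = Irrelevant.⊥-elim (M,M-isCorner (subst (λ (a , b) → a < M ⊎ b < M) x,y≡M,M nc))
      where
      x,y≡M,M : (x , y) ≡ (M , M)
      x,y≡M,M = vertex-injective (recompute≤ x≤M , recompute≤ y≤M) (≤-refl , ≤-refl)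
                  (toℕ-injective (trans (sym eq) (sym toℕ-vertex-M,M)))

  coordinates-notCorner : ∀ (i : Fin f) → let (a , b) = coordinates (inject₁ i) in a < M ⊎ b < M
  coordinates-notCorner i = decidable-stable ((a <? M) ⊎-dec (b <? M)) λ ¬nc → <⇒≢ (toℕ<n i) (begin
    toℕ i                                    ≡⟨ toℕ-inject₁ i ⟨
    toℕ (inject₁ i)                          ≡⟨ cong toℕ (vertex-coordinates (inject₁ i)) ⟨
    toℕ (vertex (a , b))                     ≡⟨ cong (toℕ ∘ vertex) (cong₂ _,_ (≮M⇒≡M a≤M (¬nc ∘ inj₁)) (≮M⇒≡M b≤M (¬nc ∘ inj₂))) ⟩
    toℕ (vertex (M , M))                     ≡⟨ toℕ-vertex-M,M ⟩
    f                                        ∎)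
    where
    open ≡-Reasoning
    a b : ℕ
    a = proj₁ (coordinates (inject₁ i))
    b = proj₂ (coordinates (inject₁ i))
    a≤M : a ≤ M
    a≤M = proj₁ (coordinates-inGrid (inject₁ i))
    b≤M : b ≤ M
    b≤M = proj₂ (coordinates-inGrid (inject₁ i))

  cellAt : Fin f → Cell
  cellAt i = let (a , b) = coordinates (inject₁ i) ; (a≤M , b≤M) = coordinates-inGrid (inject₁ i) in
    cell a b a≤M b≤M (coordinates-notCorner i)

  Cell↔Fin : Cell ↔ Fin f
  Cell↔Fin = mk↔ₛ′ cellIndex cellAt index-at at-index
    where
    index-at : ∀ i → cellIndex (cellAt i) ≡ i
    index-at i = inject₁≡⇒lower₁≡ _ (sym (vertex-coordinates (inject₁ i)))
    at-index : ∀ c → cellAt (cellIndex c) ≡ c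
    at-index c@(cell x y x≤M y≤M nc) = cell-cong (cong proj₁ eq) (cong proj₂ eq)
      where
      eq : coordinates (inject₁ (cellIndex c)) ≡ (x , y)
      eq = trans (cong coordinates (inject₁-lower₁ (vertex (x , y)) _)) (coordinates-vertex (recompute≤ x≤M , recompute≤ y≤M))

  Side↔Fin4 : Side ↔ Fin 4
  Side↔Fin4 = mk↔ₛ′ to from to-from from-to
    where
    to : Side → Fin 4
    to bottom = 0F
    to right  = 1F
    to top    = 2F
    to left   = 3F
    from : Fin 4 → Side
    from 0F = bottom
    from 1F = right
    from 2F = top
    from 3F = left
    to-from : ∀ i → to (from i) ≡ i
    to-from 0F = refl
    to-from 1F = refl
    to-from 2F = refl
    to-from 3F = refl
    from-to : ∀ d → from (to d) ≡ d
    from-to bottom = refl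
    from-to right  = refl
    from-to top    = refl
    from-to left   = refl

  Flag↔Fin : Flag ↔ Fin (8 * f)
  Flag↔Fin = ↔-trans Flag↔Product (↔-trans ((↔-trans (Side↔Fin4 ×-↔ ↔-sym 2↔Bool) (↔-sym *↔×)) ×-↔ Cell↔Fin) (↔-sym *↔×))
    where
    Flag↔Product : Flag ↔ ((Side × Bool) × Cell)
    Flag↔Product = mk↔ₛ′ (λ (flag c d t) → (d , t) , c) (λ ((d , t) , c) → flag c d t) (λ _ → refl) (λ _ → refl)

  flags : QuadFlags Flag (K * K)
  flags = record
    { τ₀ = τ₀ ; τ₁ = τ₁ ; τ₂ = τ₂
    ; τ₀-inv    = τ₀-fpfInvolution
    ; τ₁-inv    = τ₁-fpfInvolution
    ; τ₂-inv    = τ₂-fpfInvolution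
    ; τ₀τ₂-comm = τ₀τ₂-comm
    ; τ₀τ₂-fpf  = τ₀τ₂-fpf
    ; connected = connected
    ; vtx       = vtx
    ; vtx-surj  = vtx-surjective
    ; vtx-τ₁    = λ q → cong vertex (τ₁-corner q)
    ; vtx-τ₂    = λ q → cong vertex (τ₂-corner q)
    ; vtx-orbit = vtx-orbit
    ; face4     = face4
    ; face-not2 = face-not2
    }


  euler : K * K + f ≡ 2 * f + 1
  euler = sym (trans (+-comm (2 * f) 1) (cong (λ z → suc (f + z)) (+-identityʳ f)))

  quadrangulation : ProjQuad (K * K)
  quadrangulation = Transport.projQuad flags Flag↔Fin euler

  adjacent : ∀ q {v w} → flagCorner q ≡ v → flagCorner (τ₀ q) ≡ w → Adj quadrangulation (vertex v) (vertex w)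
  adjacent q refl refl = Transport.projQuad-adj flags Flag↔Fin euler q

  möbiusGrid : MöbiusGrid (Adj quadrangulation) M
  möbiusGrid = record
    { node           = λ x y → vertex (x , y)
    ; node-injective = λ x≤M y≤M x′≤M y′≤M eq →
                         let x,y≡x′,y′ = vertex-injective (x≤M , y≤M) (x′≤M , y′≤M) eq in cong proj₁ x,y≡x′,y′ , cong proj₂ x,y≡x′,y′
    ; horizontal     = λ {x} {y} → horizontal {x} {y}
    ; vertical       = λ {x} {y} → vertical {x} {y}
    ; twisted        = λ {y} {y′} → twisted {y} {y′}
    }
    where
    horizontal : ∀ {x y} → x < M → y ≤ M → Adj quadrangulation (vertex (x , y)) (vertex (suc x , y))
    horizontal {x} {y} x<M y≤M =
      adjacent (flag (cell x y (<⇒≤ x<M) y≤M (inj₁ x<M)) bottom false) {x , y} {suc x , y} refl (rightOf-< x<M)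

    vertical : ∀ {x y} → x ≤ M → y < M → Adj quadrangulation (vertex (x , y)) (vertex (x , suc y))
    vertical {x} {y} x≤M y<M =
      adjacent (flag (cell x y x≤M (<⇒≤ y<M) (inj₂ y<M)) left true) {x , y} {x , suc y} refl (above-< y<M)

    twisted : ∀ {y y′} → y + y′ ≡ M → Adj quadrangulation (vertex (M , y)) (vertex (0 , y′))
    twisted {y} {y′} y+y′≡M = by-cases (y <? M)
      where
      by-cases : Dec (y < M) → Adj quadrangulation (vertex (M , y)) (vertex (0 , y′))
      by-cases (yes y<M) = adjacent (flag (cell M y ≤-refl (<⇒≤ y<M) (inj₂ y<M)) bottom false) {M , y} {0 , y′} refl
                             (trans (rightOf-≮ M≮M) (cong (0 ,_) (trans (cong (_∸ y) (sym y+y′≡M)) (m+n∸m≡n y y′))))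
      by-cases (no y≮M)  = adjacent cornerFlag {M , y} {0 , y′} (trans (rightOf-< ≤-refl) (cong (M ,_) (sym y≡M)))
                             (trans (top-< ≤-refl) (trans (above-≮ M≮M) (cong₂ _,_ (n∸n≡0 p) (sym y′≡0))))
        where
        y≡M : y ≡ M
        y≡M = ≮M⇒≡M (subst (y ≤_) y+y′≡M (m≤m+n y y′)) y≮M
        y′≡0 : y′ ≡ 0
        y′≡0 = +-cancelˡ-≡ y y′ 0 (trans y+y′≡M (trans (sym y≡M) (sym (+-identityʳ y))))


theorem1p3 : ∀ (N : ℕ) → ∃ λ (n : ℕ) → N ≤ n × 0 < n × ∃ λ (Q : ProjQuad n) → ¬ Bipartite Q × (∀ (S : Subset n) → IsOddCycleTransversal Q S → ¬ (∣ S ∣ * ∣ S ∣ < n))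
theorem1p3 N = K * K , N≤K*K , s≤s z≤n , quadrangulation , not-bipartite , large-transversals
  where
  open ProjectiveGridMap N using (M; K; quadrangulation; möbiusGrid)

  N≤K*K : N ≤ K * K
  N≤K*K = ≤-trans (≤-trans (n≤1+n N) (n≤1+n M)) (m≤m*n K K)

  not-bipartite : ¬ Bipartite quadrangulation
  not-bipartite (c , proper) = n≮0 (subst (K ≤_) (∣⊥∣≡0 (K * K)) (oddCycleTransversal-size möbiusGrid ∅ c (λ u w e _ _ → proper u w e)))

  large-transversals : ∀ S → IsOddCycleTransversal quadrangulation S → ¬ (∣ S ∣ * ∣ S ∣ < K * K)
  large-transversals S (c , proper) = ≤⇒≯ (*-mono-≤ K≤∣S∣ K≤∣S∣)
    where
    K≤∣S∣ : K ≤ ∣ S ∣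
    K≤∣S∣ = oddCycleTransversal-size möbiusGrid S c proper
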